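{- Let $G$ be a graph of order $n\ge 3$ with no isolated vertices. Then \[ n-\gamma^c_2(G)\le \operatorname{Z_+IR}(G)\le n-\gamma(G).\] Moreover, both bounds are sharp, i.e., each holds with equality for some graph satisfying the hypotheses.
   Context: Graphs are finite, simple, undirected. $\gamma(G)$ is the domination number. A set $D\subseteq V(G)$ is a connected 2-dominating set if $G[D]$ is connected and every vertex of $V(G)\setminus D$ is adjacent to at least two vertices of $D$; $\gamma^c_2(G)$ is the minimum cardinality of a connected 2-dominating set (taken as $+\infty$ if none exists). A (standard) fort is a nonempty $F\subseteq V(G)$ with $|F\cap N(v)|\ne 1$ for all $v\in V(G)\setminus F$. A nonempty $F\subseteq V(G)$ is a PSD fort if the vertex set of each connected component of $G[F]$ is a standard fort of $G$. $S\subseteq V(G)$ is a $\operatorname{Z}_+$Ir-set if for every $u\in S$ there is a PSD fort $F$ with $S\cap F=\{u\}$. $\operatorname{Z_+IR}(G)$ is the maximum cardinality of a $\operatorname{Z}_+$Ir-set of $G$. -}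

module Defs where

open import Data.Nat using (ℕ; _≤_; _∸_; _+_)
open import Data.Bool using (Bool; true; false)
open import Data.Fin using (Fin)
open import Data.Fin.Subset using (Subset; _∈_; _∉_; _⊆_; _∩_; ∣_∣; ⁅_⁆; Nonempty)
open import Data.Vec using (tabulate)
open import Data.Product using (Σ; ∃; _×_)
open import Relation.Binary.PropositionalEquality using (_≡_; _≢_)

record Graph (n : ℕ) : Set where
  field
    adj    : Fin n → Fin n → Bool
    sym    : ∀ u v → adj u v ≡ adj v u
    irrefl : ∀ u → adj u u ≡ false

module _ {n : ℕ} (G : Graph n) where
  open Graph G

  Adj : Fin n → Fin n → Set
  Adj u v = adj u v ≡ true

  N : Fin n → Subset n
  N v = tabulate (adj v)

  NoIsolated : Set
  NoIsolated = ∀ v → ∃ λ u → Adj v u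

  -- walks staying inside D (starting vertex assumed in D by the caller)
  data ReachIn (D : Subset n) : Fin n → Fin n → Set where
    here : ∀ {u} → ReachIn D u u
    step : ∀ {u w v} → Adj u w → w ∈ D → ReachIn D w v → ReachIn D u v

  Connected : Subset n → Set
  Connected D = ∀ u v → u ∈ D → v ∈ D → ReachIn D u v

  Dominating : Subset n → Set
  Dominating D = ∀ v → v ∉ D → ∃ λ u → u ∈ D × Adj u v

  TwoDominating : Subset n → Set
  TwoDominating D = ∀ v → v ∉ D → 2 ≤ ∣ D ∩ N v ∣

  ConnectedTwoDominating : Subset n → Set
  ConnectedTwoDominating D = Connected D × TwoDominating D

  IsDominationNumber : ℕ → Set
  IsDominationNumber k =
    (Σ (Subset n) λ D → Dominating D × ∣ D ∣ ≡ k) ×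
    (∀ D → Dominating D → k ≤ ∣ D ∣)

  -- k = γ^c_2(G) (finite case; if no connected 2-dominating set exists,
  -- no k satisfies this, matching γ^c_2 = +∞)
  IsConnTwoDomNumber : ℕ → Set
  IsConnTwoDomNumber k =
    (Σ (Subset n) λ D → ConnectedTwoDominating D × ∣ D ∣ ≡ k) ×
    (∀ D → ConnectedTwoDominating D → k ≤ ∣ D ∣)

  IsFort : Subset n → Set
  IsFort F = Nonempty F × (∀ v → v ∉ F → ∣ F ∩ N v ∣ ≢ 1)

  IsComponentOf : Subset n → Subset n → Set
  IsComponentOf F C =
    Nonempty C × C ⊆ F × Connected C ×
    (∀ u w → u ∈ C → w ∈ F → Adj u w → w ∈ C)

  IsPSDFort : Subset n → Set
  IsPSDFort F = Nonempty F × (∀ C → IsComponentOf F C → IsFort C)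

  IsZIrSet : Subset n → Set
  IsZIrSet S = ∀ u → u ∈ S → Σ (Subset n) λ F → IsPSDFort F × S ∩ F ≡ ⁅ u ⁆

  IsZPlusIR : ℕ → Set
  IsZPlusIR k =
    (Σ (Subset n) λ S → IsZIrSet S × ∣ S ∣ ≡ k) ×
    (∀ S → IsZIrSet S → ∣ S ∣ ≤ k)

-- If D is a connected 2-dominating set and u ∉ D, then D ∪ {u} is a PSD fort meeting V ∖ D
-- only in u, so V ∖ D is a Z₊Ir-set.  Conversely, if S is a Z₊Ir-set, every u ∈ S has a
-- neighbour outside S (its fort cannot have the non-fort {u} as a component), so V ∖ S
-- dominates.  K₃ and K₄ minus an edge attain the two bounds.
module Submission where

open import Defs
open import Data.Nat using (ℕ; _≤_; _∸_; s≤s; _≤?_)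
import Data.Nat as ℕ
open import Data.Nat.Properties using (≤-trans; m∸n≡0⇒m≤n; ∸-monoʳ-≤; m∸[m∸n]≡n)
open import Data.Bool using (Bool; true; false)
open import Data.Bool.Properties using () renaming (_≟_ to _≟ᵇ_)
open import Data.Fin using (Fin; zero; suc; #_)
open import Data.Fin.Properties using (all?; any?)
open import Data.Fin.Subset
open import Data.Fin.Subset.Properties
open import Data.Vec using (Vec; lookup; _∷_; [])
open import Data.Vec.Properties using (lookup⇒[]=; []=⇒lookup; lookup∘tabulate)
open import Data.Product using (Σ; _×_; _,_; proj₁; proj₂)
open import Data.Sum using (inj₁; inj₂)
open import Function using (_∘_)
open import Relation.Nullary using (¬_; Dec; yes; no; contradiction)
open import Relation.Nullary.Decidable using (True; False; toWitness; toWitnessFalse; from-yes; from-no; ¬?; _×-dec_; _→-dec_)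
open import Relation.Binary.PropositionalEquality

2≰1 : ¬ 2 ≤ 1
2≰1 (s≤s ())

x∈p⇒1≤∣p∣ : ∀ {n} {x : Fin n} {p : Subset n} → x ∈ p → 1 ≤ ∣ p ∣
x∈p⇒1≤∣p∣ {x = x} x∈p =
  subst (_≤ _) (∣⁅x⁆∣≡1 x) (p⊆q⇒∣p∣≤∣q∣ λ y∈⁅x⁆ → subst (_∈ _) (sym (x∈⁅y⁆⇒x≡y x y∈⁅x⁆)) x∈p)

∁-empty⇒n≤∣p∣ : ∀ {n} (p : Subset n) → Empty (∁ p) → n ≤ ∣ p ∣
∁-empty⇒n≤∣p∣ {n} p empty = m∸n≡0⇒m≤n (begin
  n ∸ ∣ p ∣  ≡⟨ sym (∣∁p∣≡n∸∣p∣ p) ⟩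
  ∣ ∁ p ∣    ≡⟨ cong ∣_∣ (Empty-unique empty) ⟩
  ∣ ⊥ {n} ∣  ≡⟨ ∣⊥∣≡0 n ⟩
  0          ∎)
  where open ≡-Reasoning

∩≡⁅⁆⇒∈ʳ : ∀ {n} {S F : Subset n} {u} → S ∩ F ≡ ⁅ u ⁆ → u ∈ F
∩≡⁅⁆⇒∈ʳ {S = S} {F} {u} eq = proj₂ (x∈p∩q⁻ S F (subst (u ∈_) (sym eq) (x∈⁅x⁆ u)))

∩≡⁅⁆⇒≡ : ∀ {n} {S F : Subset n} {u w} → S ∩ F ≡ ⁅ u ⁆ → w ∈ S → w ∈ F → w ≡ u
∩≡⁅⁆⇒≡ {u = u} eq w∈S w∈F = x∈⁅y⁆⇒x≡y u (subst (_ ∈_) eq (x∈p∩q⁺ (w∈S , w∈F)))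

module _ {n : ℕ} (G : Graph n) where
  open Graph G renaming (sym to adj-sym)

  Adj-sym : ∀ {u v} → Adj G u v → Adj G v u
  Adj-sym {u} {v} uv = trans (adj-sym v u) uv

  Adj-irrefl : ∀ {u} → ¬ Adj G u u
  Adj-irrefl {u} uu with trans (sym (irrefl u)) uu
  ... | ()

  Adj⇒∈N : ∀ {u v} → Adj G u v → v ∈ N G u
  Adj⇒∈N {u} {v} uv = lookup⇒[]= v _ (trans (lookup∘tabulate (adj u) v) uv)

  Adj? : ∀ u v → Dec (Adj G u v)
  Adj? u v = adj u v ≟ᵇ true

  noIsolated? : Dec (NoIsolated G)
  noIsolated? = all? λ v → any? λ u → Adj? v u

  dominating? : ∀ D → Dec (Dominating G D)
  dominating? D = all? λ v → ¬? (v ∈? D) →-dec any? λ u → (u ∈? D) ×-dec Adj? u v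

  twoDominating? : ∀ D → Dec (TwoDominating G D)
  twoDominating? D = all? λ v → ¬? (v ∈? D) →-dec 2 ≤? ∣ D ∩ N G v ∣

  isFort? : ∀ F → Dec (IsFort G F)
  isFort? F = nonempty? F ×-dec all? λ v → ¬? (v ∈? F) →-dec ¬? (∣ F ∩ N G v ∣ ℕ.≟ 1)

  connected-⁅⁆ : ∀ v → Connected G ⁅ v ⁆
  connected-⁅⁆ v a b a∈ b∈ rewrite x∈⁅y⁆⇒x≡y v a∈ | x∈⁅y⁆⇒x≡y v b∈ = here

  connected-⁅⁆∪⁅⁆ : ∀ {u v} → Adj G u v → Connected G (⁅ u ⁆ ∪ ⁅ v ⁆)
  connected-⁅⁆∪⁅⁆ {u} {v} uv a b a∈ b∈ with x∈p∪q⁻ ⁅ u ⁆ ⁅ v ⁆ a∈ | x∈p∪q⁻ ⁅ u ⁆ ⁅ v ⁆ b∈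
  ... | inj₁ a∈⁅u⁆ | inj₁ b∈⁅u⁆ rewrite x∈⁅y⁆⇒x≡y u a∈⁅u⁆ | x∈⁅y⁆⇒x≡y u b∈⁅u⁆ = here
  ... | inj₂ a∈⁅v⁆ | inj₂ b∈⁅v⁆ rewrite x∈⁅y⁆⇒x≡y v a∈⁅v⁆ | x∈⁅y⁆⇒x≡y v b∈⁅v⁆ = here
  ... | inj₁ a∈⁅u⁆ | inj₂ b∈⁅v⁆ rewrite x∈⁅y⁆⇒x≡y u a∈⁅u⁆ | x∈⁅y⁆⇒x≡y v b∈⁅v⁆ =
    step uv (x∈p∪q⁺ (inj₂ (x∈⁅x⁆ v))) here
  ... | inj₂ a∈⁅v⁆ | inj₁ b∈⁅u⁆ rewrite x∈⁅y⁆⇒x≡y v a∈⁅v⁆ | x∈⁅y⁆⇒x≡y u b∈⁅u⁆ =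
    step (Adj-sym uv) (x∈p∪q⁺ (inj₁ (x∈⁅x⁆ u))) here

  connected⇒isComponentOf-self : ∀ {F} → Nonempty F → Connected G F → IsComponentOf G F F
  connected⇒isComponentOf-self ne conn = ne , (λ x∈F → x∈F) , conn , λ _ _ _ w∈F _ → w∈F

  ReachIn-closed : ∀ {D F C a b} → D ⊆ F → (∀ u w → u ∈ C → w ∈ F → Adj G u w → w ∈ C) →
                   ReachIn G D a b → a ∈ C → b ∈ C
  ReachIn-closed D⊆F closed here a∈C = a∈C
  ReachIn-closed D⊆F closed (step aw w∈D walk) a∈C =
    ReachIn-closed D⊆F closed walk (closed _ _ a∈C (D⊆F w∈D) aw)

  connected⊆isComponentOf : ∀ {D F C d} → IsComponentOf G F C → D ⊆ F → Connected G D →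
                            d ∈ D → d ∈ C → D ⊆ C
  connected⊆isComponentOf (_ , _ , _ , closed) D⊆F conn d∈D d∈C x∈D =
    ReachIn-closed D⊆F closed (conn _ _ d∈D x∈D) d∈C

  twoDominating⇒dominating : ∀ {D} → TwoDominating G D → Dominating G D
  twoDominating⇒dominating {D} td v v∉D with nonempty? (D ∩ N G v)
  ... | yes (u , u∈D∩Nv) = u , proj₁ (x∈p∩q⁻ D _ u∈D∩Nv) ,
    Adj-sym (trans (sym (lookup∘tabulate (adj v) u)) ([]=⇒lookup (proj₂ (x∈p∩q⁻ D _ u∈D∩Nv))))
  ... | no empty = contradiction (subst (2 ≤_) (trans (cong ∣_∣ (Empty-unique empty)) (∣⊥∣≡0 n)) (td v v∉D)) λ ()

  dominating⇒1≤∣D∣ : ∀ {D} → Fin n → Dominating G D → 1 ≤ ∣ D ∣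
  dominating⇒1≤∣D∣ {D} v dom with v ∈? D
  ... | yes v∈D = x∈p⇒1≤∣p∣ v∈D
  ... | no v∉D = x∈p⇒1≤∣p∣ (proj₁ (proj₂ (dom v v∉D)))

  twoDominating⇒2≤∣D∣ : ∀ {D} → 2 ≤ n → TwoDominating G D → 2 ≤ ∣ D ∣
  twoDominating⇒2≤∣D∣ {D} 2≤n td with nonempty? (∁ D)
  ... | yes (v , v∈∁D) = ≤-trans (td v (x∈∁p⇒x∉p v∈∁D)) (∣p∩q∣≤∣p∣ D _)
  ... | no empty = ≤-trans 2≤n (∁-empty⇒n≤∣p∣ D empty)

  twoDominating⊆⇒isFort : ∀ {D C} → TwoDominating G D → D ⊆ C → Nonempty C → IsFort G C
  twoDominating⊆⇒isFort {D} {C} td D⊆C neC = neC , λ v v∉C ∣C∩Nv∣≡1 →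
    2≰1 (subst (2 ≤_) ∣C∩Nv∣≡1 (≤-trans (td v (v∉C ∘ D⊆C)) (p⊆q⇒∣p∣≤∣q∣ λ x∈D∩Nv →
      let (x∈D , x∈Nv) = x∈p∩q⁻ D _ x∈D∩Nv in x∈p∩q⁺ (D⊆C x∈D , x∈Nv))))

  adjacent⇒¬isFort-⁅⁆ : ∀ {u v} → Adj G u v → ¬ IsFort G ⁅ v ⁆
  adjacent⇒¬isFort-⁅⁆ {u} {v} uv (_ , fort) = fort u u∉⁅v⁆ (begin
    ∣ ⁅ v ⁆ ∩ N G u ∣ ≡⟨ cong ∣_∣ (⊆-antisym (p∩q⊆p ⁅ v ⁆ _) ⁅v⁆⊆Nu) ⟩
    ∣ ⁅ v ⁆ ∣         ≡⟨ ∣⁅x⁆∣≡1 v ⟩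
    1                 ∎)
    where
    open ≡-Reasoning
    u∉⁅v⁆ : u ∉ ⁅ v ⁆
    u∉⁅v⁆ u∈⁅v⁆ = Adj-irrefl (subst (Adj G u) (sym (x∈⁅y⁆⇒x≡y v u∈⁅v⁆)) uv)
    ⁅v⁆⊆Nu : ⁅ v ⁆ ⊆ ⁅ v ⁆ ∩ N G u
    ⁅v⁆⊆Nu x∈⁅v⁆ rewrite x∈⁅y⁆⇒x≡y v x∈⁅v⁆ = x∈p∩q⁺ (x∈⁅x⁆ v , Adj⇒∈N uv)

  connected∧¬isFort⇒¬isPSDFort : ∀ {F} → Nonempty F → Connected G F → ¬ IsFort G F → ¬ IsPSDFort G F
  connected∧¬isFort⇒¬isPSDFort ne conn ¬fort (_ , forts) =
    ¬fort (forts _ (connected⇒isComponentOf-self ne conn))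

  -- Every component of F meets D (a vertex outside D has a neighbour in D), hence contains
  -- the connected set D, and a superset of a 2-dominating set is a fort.
  connectedTwoDominating⊆⇒isPSDFort : ∀ {D F} → ConnectedTwoDominating G D → D ⊆ F → Nonempty F →
                                      IsPSDFort G F
  connectedTwoDominating⊆⇒isPSDFort {D} {F} (conn , td) D⊆F neF = neF , λ C comp →
    twoDominating⊆⇒isFort td (D⊆C C comp) (proj₁ comp)
    where
    D⊆C : ∀ C → IsComponentOf G F C → D ⊆ C
    D⊆C C comp@((c , c∈C) , _ , _ , closed) with c ∈? D
    ... | yes c∈D = connected⊆isComponentOf comp D⊆F conn c∈D c∈C
    ... | no c∉D with twoDominating⇒dominating td c c∉D
    ...   | d , d∈D , dc = connected⊆isComponentOf comp D⊆F conn d∈D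
                             (closed c d c∈C (D⊆F d∈D) (Adj-sym dc))

  connectedTwoDominating⇒isPSDFort : ∀ {D} → Nonempty D → ConnectedTwoDominating G D → IsPSDFort G D
  connectedTwoDominating⇒isPSDFort neD ctd = connectedTwoDominating⊆⇒isPSDFort ctd (λ x∈D → x∈D) neD

  ∁-connectedTwoDominating⇒isZIrSet : ∀ {D} → ConnectedTwoDominating G D → IsZIrSet G (∁ D)
  ∁-connectedTwoDominating⇒isZIrSet {D} ctd u u∈∁D =
    D ∪ ⁅ u ⁆ , connectedTwoDominating⊆⇒isPSDFort ctd (p⊆p∪q ⁅ u ⁆) (u , u∈D∪⁅u⁆) ,
    ⊆-antisym ∁D∩F⊆⁅u⁆ ⁅u⁆⊆∁D∩F
    where
    u∈D∪⁅u⁆ = q⊆p∪q D ⁅ u ⁆ (x∈⁅x⁆ u)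
    ∁D∩F⊆⁅u⁆ : ∁ D ∩ (D ∪ ⁅ u ⁆) ⊆ ⁅ u ⁆
    ∁D∩F⊆⁅u⁆ x∈ with x∈p∩q⁻ (∁ D) _ x∈
    ... | x∈∁D , x∈F with x∈p∪q⁻ D ⁅ u ⁆ x∈F
    ...   | inj₁ x∈D = contradiction x∈D (x∈∁p⇒x∉p x∈∁D)
    ...   | inj₂ x∈⁅u⁆ = x∈⁅u⁆
    ⁅u⁆⊆∁D∩F : ⁅ u ⁆ ⊆ ∁ D ∩ (D ∪ ⁅ u ⁆)
    ⁅u⁆⊆∁D∩F x∈⁅u⁆ rewrite x∈⁅y⁆⇒x≡y u x∈⁅u⁆ = x∈p∩q⁺ (u∈∁D , u∈D∪⁅u⁆)

  -- If no neighbour of u ∈ S lies in the fort F for u, then ⁅ u ⁆ is a component of F,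
  -- which cannot be a fort since u is not isolated.
  isZIrSet⇒∁-dominating : NoIsolated G → ∀ {S} → IsZIrSet G S → Dominating G (∁ S)
  isZIrSet⇒∁-dominating noIso {S} zir u u∉∁S with zir u (x∉∁p⇒x∈p u∉∁S)
  ... | F , (_ , forts) , S∩F≡⁅u⁆ with any? (λ w → (w ∈? F) ×-dec Adj? u w)
  ...   | yes (w , w∈F , uw) =
    w , x∉p⇒x∈∁p (λ w∈S → Adj-irrefl (subst (Adj G u) (∩≡⁅⁆⇒≡ S∩F≡⁅u⁆ w∈S w∈F) uw)) , Adj-sym uw
  ...   | no ¬nbr = contradiction (forts ⁅ u ⁆ ⁅u⁆-component) (adjacent⇒¬isFort-⁅⁆ (Adj-sym (proj₂ (noIso u))))
    where
    u∈F = ∩≡⁅⁆⇒∈ʳ S∩F≡⁅u⁆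
    ⁅u⁆-component : IsComponentOf G F ⁅ u ⁆
    ⁅u⁆-component = (u , x∈⁅x⁆ u) , (λ x∈⁅u⁆ → subst (_∈ F) (sym (x∈⁅y⁆⇒x≡y u x∈⁅u⁆)) u∈F) ,
      connected-⁅⁆ u , λ x w x∈⁅u⁆ w∈F xw →
        contradiction (w , w∈F , subst (λ y → Adj G y w) (x∈⁅y⁆⇒x≡y u x∈⁅u⁆) xw) ¬nbr

  n∸γᶜ₂≤Z₊IR : ∀ {c z} → IsConnTwoDomNumber G c → IsZPlusIR G z → n ∸ c ≤ z
  n∸γᶜ₂≤Z₊IR {c} {z} ((D , ctd , ∣D∣≡c) , _) (_ , maximal) =
    subst (_≤ z) (trans (∣∁p∣≡n∸∣p∣ D) (cong (n ∸_) ∣D∣≡c))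
      (maximal (∁ D) (∁-connectedTwoDominating⇒isZIrSet ctd))

  ∣ZIrSet∣≤n∸γ : NoIsolated G → ∀ {g S} → IsDominationNumber G g → IsZIrSet G S → ∣ S ∣ ≤ n ∸ g
  ∣ZIrSet∣≤n∸γ noIso {g} {S} (_ , minimal) zir = subst (_≤ n ∸ g) (m∸[m∸n]≡n (∣p∣≤n S))
    (∸-monoʳ-≤ n (subst (g ≤_) (∣∁p∣≡n∸∣p∣ S) (minimal (∁ S) (isZIrSet⇒∁-dominating noIso zir))))

  Z₊IR≤n∸γ : NoIsolated G → ∀ {g z} → IsDominationNumber G g → IsZPlusIR G z → z ≤ n ∸ g
  Z₊IR≤n∸γ noIso {g} γ ((S , zir , ∣S∣≡z) , _) = subst (_≤ n ∸ g) ∣S∣≡z (∣ZIrSet∣≤n∸γ noIso γ zir)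

∈-by-decision : ∀ {n} {x : Fin n} {p} {x∈p : True (x ∈? p)} → x ∈ p
∈-by-decision {x∈p = x∈p} = toWitness x∈p

∉-by-decision : ∀ {n} {x : Fin n} {p} {x∉p : False (x ∈? p)} → x ∉ p
∉-by-decision {x∉p = x∉p} = toWitnessFalse x∉p

≤-by-decision : ∀ {m n} {m≤n : True (m ≤? n)} → m ≤ n
≤-by-decision {m≤n = m≤n} = toWitness m≤n

fromAdjacencyMatrix : ∀ {n} (M : Vec (Vec Bool n) n) →
  {True (all? λ u → all? λ v → lookup (lookup M u) v ≟ᵇ lookup (lookup M v) u)} →
  {True (all? λ u → lookup (lookup M u) u ≟ᵇ false)} → Graph n
fromAdjacencyMatrix M {symmetric} {irreflexive} = record
  { adj = λ u v → lookup (lookup M u) v ; sym = toWitness symmetric ; irrefl = toWitness irreflexive }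

K₃ : Graph 3
K₃ = fromAdjacencyMatrix
  ( (false ∷ true  ∷ true  ∷ [])
  ∷ (true  ∷ false ∷ true  ∷ [])
  ∷ (true  ∷ true  ∷ false ∷ [])
  ∷ [])

-- K₄ minus the edge {2, 3}
K₄-e : Graph 4
K₄-e = fromAdjacencyMatrix
  ( (false ∷ true  ∷ true  ∷ true  ∷ [])
  ∷ (true  ∷ false ∷ true  ∷ true  ∷ [])
  ∷ (true  ∷ true  ∷ false ∷ false ∷ [])
  ∷ (true  ∷ true  ∷ false ∷ false ∷ [])
  ∷ [])

noIsolated-K₃ : NoIsolated K₃
noIsolated-K₃ = from-yes (noIsolated? K₃)

noIsolated-K₄-e : NoIsolated K₄-e
noIsolated-K₄-e = from-yes (noIsolated? K₄-e)

γ-K₃ : IsDominationNumber K₃ 1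
γ-K₃ = (⁅ # 0 ⁆ , from-yes (dominating? K₃ ⁅ # 0 ⁆) , refl) , λ D → dominating⇒1≤∣D∣ K₃ (# 0)

Z₊IR-K₃ : IsZPlusIR K₃ 2
Z₊IR-K₃ = (⁅ # 1 ⁆ ∪ ⁅ # 2 ⁆ , ZIrSet , refl) , λ S → ∣ZIrSet∣≤n∸γ K₃ noIsolated-K₃ γ-K₃
  where
  edgeFort : ∀ v → Adj K₃ (# 0) v → True (twoDominating? K₃ (⁅ # 0 ⁆ ∪ ⁅ v ⁆)) →
             IsPSDFort K₃ (⁅ # 0 ⁆ ∪ ⁅ v ⁆)
  edgeFort v 0v td = connectedTwoDominating⇒isPSDFort K₃ (# 0 , p⊆p∪q ⁅ v ⁆ (x∈⁅x⁆ (# 0)))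
    (connected-⁅⁆∪⁅⁆ K₃ {# 0} {v} 0v , toWitness td)
  ZIrSet : IsZIrSet K₃ (⁅ # 1 ⁆ ∪ ⁅ # 2 ⁆)
  ZIrSet zero 0∈S = contradiction 0∈S ∉-by-decision
  ZIrSet (suc zero) _ = _ , edgeFort (# 1) refl _ , refl
  ZIrSet (suc (suc zero)) _ = _ , edgeFort (# 2) refl _ , refl

connectedTwoDominating-K₄-e : ConnectedTwoDominating K₄-e (⁅ # 0 ⁆ ∪ ⁅ # 1 ⁆)
connectedTwoDominating-K₄-e =
  connected-⁅⁆∪⁅⁆ K₄-e {# 0} {# 1} refl , from-yes (twoDominating? K₄-e (⁅ # 0 ⁆ ∪ ⁅ # 1 ⁆))

γᶜ₂-K₄-e : IsConnTwoDomNumber K₄-e 2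
γᶜ₂-K₄-e = (_ , connectedTwoDominating-K₄-e , refl) , λ D → twoDominating⇒2≤∣D∣ K₄-e ≤-by-decision ∘ proj₂

-- The vertices 2 and 3 are non-adjacent twins with neighbourhood {0, 1}.
psdFort∋2∌3⇒∋0,1 : ∀ {F} → IsPSDFort K₄-e F → # 2 ∈ F → # 3 ∉ F → # 0 ∈ F × # 1 ∈ F
psdFort∋2∌3⇒∋0,1 {true ∷ true ∷ _ ∷ _ ∷ []} _ _ _ = ∈-by-decision , ∈-by-decision
psdFort∋2∌3⇒∋0,1 {F@(true ∷ false ∷ true ∷ false ∷ [])} psd _ _ = contradiction psd
  (connected∧¬isFort⇒¬isPSDFort K₄-e (# 0 , ∈-by-decision) (connected-⁅⁆∪⁅⁆ K₄-e {# 0} {# 2} refl)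
    (from-no (isFort? K₄-e F)))
psdFort∋2∌3⇒∋0,1 {F@(false ∷ true ∷ true ∷ false ∷ [])} psd _ _ = contradiction psd
  (connected∧¬isFort⇒¬isPSDFort K₄-e (# 1 , ∈-by-decision) (connected-⁅⁆∪⁅⁆ K₄-e {# 1} {# 2} refl)
    (from-no (isFort? K₄-e F)))
psdFort∋2∌3⇒∋0,1 {false ∷ false ∷ true ∷ false ∷ []} psd _ _ = contradiction psd
  (connected∧¬isFort⇒¬isPSDFort K₄-e (# 2 , ∈-by-decision) (connected-⁅⁆ K₄-e (# 2))
    (adjacent⇒¬isFort-⁅⁆ K₄-e {# 0} {# 2} refl))
psdFort∋2∌3⇒∋0,1 {_ ∷ _ ∷ false ∷ _ ∷ []} _ 2∈F _ = contradiction 2∈F ∉-by-decision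
psdFort∋2∌3⇒∋0,1 {_ ∷ _ ∷ true ∷ true ∷ []} _ _ 3∉F = contradiction ∈-by-decision 3∉F

ZIrSet∋2,3⇒∌0,1 : ∀ {S} → IsZIrSet K₄-e S → # 2 ∈ S → # 3 ∈ S → # 0 ∉ S × # 1 ∉ S
ZIrSet∋2,3⇒∌0,1 zir 2∈S 3∈S with zir (# 2) 2∈S
... | F , psd , S∩F≡⁅2⁆ with psdFort∋2∌3⇒∋0,1 psd (∩≡⁅⁆⇒∈ʳ {u = # 2} S∩F≡⁅2⁆)
                               (λ 3∈F → contradiction (∩≡⁅⁆⇒≡ {u = # 2} S∩F≡⁅2⁆ 3∈S 3∈F) λ ())
...   | 0∈F , 1∈F = (λ 0∈S → contradiction (∩≡⁅⁆⇒≡ {u = # 2} S∩F≡⁅2⁆ 0∈S 0∈F) λ ())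
                  , (λ 1∈S → contradiction (∩≡⁅⁆⇒≡ {u = # 2} S∩F≡⁅2⁆ 1∈S 1∈F) λ ())

∣ZIrSet-K₄-e∣≤2 : ∀ S → IsZIrSet K₄-e S → ∣ S ∣ ≤ 2
∣ZIrSet-K₄-e∣≤2 (false ∷ true ∷ true ∷ true ∷ []) zir =
  contradiction ∈-by-decision (proj₂ (ZIrSet∋2,3⇒∌0,1 zir ∈-by-decision ∈-by-decision))
∣ZIrSet-K₄-e∣≤2 (true ∷ false ∷ true ∷ true ∷ []) zir =
  contradiction ∈-by-decision (proj₁ (ZIrSet∋2,3⇒∌0,1 zir ∈-by-decision ∈-by-decision))
∣ZIrSet-K₄-e∣≤2 S@(true ∷ true ∷ true ∷ false ∷ []) zir = contradiction
  (isZIrSet⇒∁-dominating K₄-e noIsolated-K₄-e zir) (from-no (dominating? K₄-e (∁ S)))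
∣ZIrSet-K₄-e∣≤2 S@(true ∷ true ∷ false ∷ true ∷ []) zir = contradiction
  (isZIrSet⇒∁-dominating K₄-e noIsolated-K₄-e zir) (from-no (dominating? K₄-e (∁ S)))
∣ZIrSet-K₄-e∣≤2 S@(true ∷ true ∷ true ∷ true ∷ []) zir = contradiction
  (isZIrSet⇒∁-dominating K₄-e noIsolated-K₄-e zir) (from-no (dominating? K₄-e (∁ S)))
∣ZIrSet-K₄-e∣≤2 (false ∷ false ∷ false ∷ false ∷ []) _ = ≤-by-decision
∣ZIrSet-K₄-e∣≤2 (false ∷ false ∷ false ∷ true ∷ []) _ = ≤-by-decision
∣ZIrSet-K₄-e∣≤2 (false ∷ false ∷ true ∷ false ∷ []) _ = ≤-by-decision
∣ZIrSet-K₄-e∣≤2 (false ∷ false ∷ true ∷ true ∷ []) _ = ≤-by-decision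
∣ZIrSet-K₄-e∣≤2 (false ∷ true ∷ false ∷ false ∷ []) _ = ≤-by-decision
∣ZIrSet-K₄-e∣≤2 (false ∷ true ∷ false ∷ true ∷ []) _ = ≤-by-decision
∣ZIrSet-K₄-e∣≤2 (false ∷ true ∷ true ∷ false ∷ []) _ = ≤-by-decision
∣ZIrSet-K₄-e∣≤2 (true ∷ false ∷ false ∷ false ∷ []) _ = ≤-by-decision
∣ZIrSet-K₄-e∣≤2 (true ∷ false ∷ false ∷ true ∷ []) _ = ≤-by-decision
∣ZIrSet-K₄-e∣≤2 (true ∷ false ∷ true ∷ false ∷ []) _ = ≤-by-decision
∣ZIrSet-K₄-e∣≤2 (true ∷ true ∷ false ∷ false ∷ []) _ = ≤-by-decision

Z₊IR-K₄-e : IsZPlusIR K₄-e 2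
Z₊IR-K₄-e = (_ , ∁-connectedTwoDominating⇒isZIrSet K₄-e connectedTwoDominating-K₄-e , refl) , ∣ZIrSet-K₄-e∣≤2

proposition3p16 :
    ((n : ℕ) → (G : Graph n) → 3 ≤ n → NoIsolated G →
      ((c z : ℕ) → IsConnTwoDomNumber G c → IsZPlusIR G z → n ∸ c ≤ z) ×
      ((g z : ℕ) → IsDominationNumber G g → IsZPlusIR G z → z ≤ n ∸ g)) ×
    (Σ ℕ λ n → Σ (Graph n) λ G → 3 ≤ n × NoIsolated G ×
      Σ ℕ λ c → Σ ℕ λ z → IsConnTwoDomNumber G c × IsZPlusIR G z × n ∸ c ≡ z) ×
    (Σ ℕ λ n → Σ (Graph n) λ G → 3 ≤ n × NoIsolated G ×
      Σ ℕ λ g → Σ ℕ λ z → IsDominationNumber G g × IsZPlusIR G z × z ≡ n ∸ g)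
proposition3p16 =
  (λ n G _ noIso →
     (λ _ _ → n∸γᶜ₂≤Z₊IR G) , (λ _ _ → Z₊IR≤n∸γ G noIso)) ,
  (4 , K₄-e , ≤-by-decision , noIsolated-K₄-e , 2 , 2 , γᶜ₂-K₄-e , Z₊IR-K₄-e , refl) ,
  (3 , K₃ , ≤-by-decision , noIsolated-K₃ , 1 , 2 , γ-K₃ , Z₊IR-K₃ , refl)
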